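{- Let $H_1, H_2$ be finite abelian groups such that $\mathsf{D}_{\pm}(H_i) = \lfloor \log_2 |H_i| \rfloor + 1$ for $i=1,2$ and such that $\{\log_2 |H_1|\} + \{\log_2 |H_2|\} < 1$. Then for every finite abelian group $G$ that is an extension of $H_1$ by $H_2$ (i.e., $G$ has a subgroup $H$ isomorphic to $H_2$ with $G/H$ isomorphic to $H_1$) we have $\mathsf{D}_{\pm}(G) = \lfloor \log_2 |G| \rfloor + 1$. In particular, if a finite abelian group $G$ has a subgroup $H$ such that $\mathsf{D}_{\pm}(H) = \lfloor \log_2 |H| \rfloor + 1$ and $G/H$ is a $2$-group, then $\mathsf{D}_{\pm}(G) = \lfloor \log_2 |G| \rfloor + 1$.
   Context: For a real number $x$, $\{x\} = x - \lfloor x \rfloor$ denotes its fractional part. For a finite abelian group $G$ (written additively), the plus-minus weighted Davenport constant $\mathsf{D}_{\pm}(G)$ is the smallest positive integer $\ell$ such that for every sequence $g_1,\dots,g_k$ of elements of $G$ (repetitions allowed) with $k \ge \ell$ there exist a non-empty subset $I \subset \{1,\dots,k\}$ and $a_i \in \{+1,-1\}$ ($i\in I$) with $\sum_{i \in I} a_i g_i = 0$. -}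

module Defs where

open import Data.Nat using (ℕ; zero; suc; _*_; _^_; _≤_; _<_)
import Data.Nat as ℕ
open import Data.Nat.Logarithm using (⌊log₂_⌋)
open import Data.Fin using (Fin; zero; suc)
open import Data.Product using (Σ; ∃; _×_; _,_)
open import Relation.Binary.PropositionalEquality using (_≡_)
open import Relation.Nullary using (¬_)
open import Function.Definitions using (Injective; Surjective)
open import Algebra.Structures using (IsAbelianGroup)

-- A finite abelian group, presented (up to isomorphism) on the carrier Fin order.
record FinAbGroup : Set where
  field
    order : ℕ
    _∙_   : Fin order → Fin order → Fin order
    ε     : Fin order
    _⁻¹   : Fin order → Fin order
    isAbelianGroup : IsAbelianGroup _≡_ _∙_ ε _⁻¹

open FinAbGroup public

Carrier : FinAbGroup → Set
Carrier G = Fin (order G)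

card : FinAbGroup → ℕ
card G = order G

record Hom (G H : FinAbGroup) : Set where
  field
    fun  : Carrier G → Carrier H
    homo : ∀ x y → fun (_∙_ G x y) ≡ _∙_ H (fun x) (fun y)

open Hom public

-- G is an extension of H₁ by H₂: a short exact sequence 0 → H₂ → G → H₁ → 0,
-- i.e. G has a subgroup H (= image of ι) isomorphic to H₂ with G/H ≅ H₁ (via π).
Extension : (G H₁ H₂ : FinAbGroup) → Set
Extension G H₁ H₂ =
  Σ (Hom H₂ G) λ ι → Σ (Hom G H₁) λ π →
    Injective _≡_ _≡_ (fun ι) ×
    Surjective _≡_ _≡_ (fun π) ×
    (∀ g → fun π g ≡ ε H₁ → ∃ λ h → fun ι h ≡ g) ×
    (∀ h → fun π (fun ι h) ≡ ε H₁)

-- Weights a_i ∈ {+1,-1}, or "i ∉ I" (absent).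
data Sign : Set where
  absent plus minus : Sign

signed : (G : FinAbGroup) → Sign → Carrier G → Carrier G
signed G absent x = ε G
signed G plus   x = x
signed G minus  x = _⁻¹ G x

gsum : (G : FinAbGroup) → (k : ℕ) → (Fin k → Carrier G) → Carrier G
gsum G zero    f = ε G
gsum G (suc k) f = _∙_ G (f zero) (gsum G k (λ i → f (suc i)))

HasPMZeroSum : (G : FinAbGroup) → (k : ℕ) → (Fin k → Carrier G) → Set
HasPMZeroSum G k g =
  Σ (Fin k → Sign) λ a →
    (∃ λ i → ¬ (a i ≡ absent)) ×
    gsum G k (λ i → signed G (a i) (g i)) ≡ ε G

PMGood : FinAbGroup → ℕ → Set
PMGood G ℓ = ∀ k → ℓ ≤ k → (g : Fin k → Carrier G) → HasPMZeroSum G k g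

IsDpm : FinAbGroup → ℕ → Set
IsDpm G ℓ = 1 ≤ ℓ × PMGood G ℓ × (∀ m → 1 ≤ m → PMGood G m → ℓ ≤ m)

-- {log₂ a} + {log₂ b} < 1, for positive integers a, b, written without reals:
-- equivalent to a·b < 2^(⌊log₂ a⌋ + ⌊log₂ b⌋ + 1).
FracLogSumLt1 : ℕ → ℕ → Set
FracLogSumLt1 a b = a * b < 2 ^ (⌊log₂ a ⌋ ℕ.+ ⌊log₂ b ⌋ ℕ.+ 1)

Is2Group : FinAbGroup → Set
Is2Group Q = ∃ λ m → card Q ≡ 2 ^ m

{-# OPTIONS --safe #-}
-- Upper bound: when |G| < 2^n, two of the 2^n subset sums of a sequence of length n
-- coincide, and their difference is a plus-minus weighted zero sum.  Lower bound for an
-- extension 0 → H₂ → G → H₁ → 0: lift a zero-sum free sequence of H₁ through a section of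
-- G → H₁ and append the image of one of H₂; a weighted zero sum of the concatenation
-- projects to one in H₁, and if that one is trivial it restricts to one in H₂.  The
-- condition on fractional parts says exactly that ⌊log₂ |G|⌋ = ⌊log₂ |H₁|⌋ + ⌊log₂ |H₂|⌋.
-- A 2-group Q of order 2^m has a sequence of length m whose 2^m subset sums are distinct:
-- extend a sequence whose subset sums form a subgroup S by an element z ∉ S with z² ∈ S,
-- found among the repeated squares y, y², y⁴, … of any y ∉ S, which end in the identity.
-- The second statement is the first with H₁ = Q, for which {log₂ |Q|} = 0.
module Submission where

open import Defs hiding (_∙_; ε; _⁻¹)
open import Level using (0ℓ)
open import Data.Nat using (ℕ; zero; suc; _+_; _∸_; _*_; _^_; _≤_; _<_; z≤n; s≤s; ⌊_/2⌋; NonZero; >-nonZero⁻¹)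
open import Data.Nat.Properties
  using (≤-refl; ≤-trans; ≤-antisym; ≤-pred; <-≤-trans; <⇒≤; <⇒≱; ≰⇒>; _≤?_; n≮n; m+1+n≰m; m≤n+m; m≤n+m∸n; m<m+n;
         +-comm; +-assoc; +-suc; +-identityʳ; +-mono-≤; *-monoʳ-<; ^-monoʳ-≤; ^-monoʳ-<; ^-distribˡ-+-*; *-mono-≤;
         m^n≢0; module ≤-Reasoning)
open import Data.Nat.Logarithm using (⌊log₂_⌋; ⌊log₂⌋-mono-≤; ⌊log₂[2^n]⌋≡n; ⌊log₂⌊n/2⌋⌋≡⌊log₂n⌋∸1)
open import Data.Fin using (Fin; zero; suc; finToFun; funToFin; combine; remQuot; _↑ˡ_; _↑ʳ_; splitAt)
open import Data.Fin.Patterns using (0F; 1F)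
open import Data.Fin.Properties
  using (_≟_; any?; pigeonhole; <⇒≢; ¬∀⟶∃¬; finToFun-funToFin; funToFin-finToFin; nonZeroIndex;
         combine-injective; combine-remQuot; injective⇒≤; splitAt⁻¹-↑ˡ; splitAt⁻¹-↑ʳ)
open import Data.Fin.Permutation using (Permutation′; permutation)
open import Data.Vec.Functional using ([]; _∷_; _++_)
open import Data.Vec.Functional.Properties using (lookup-++ˡ; lookup-++ʳ)
open import Data.Product using (Σ; ∃; ∃₂; _×_; _,_; proj₁; proj₂; uncurry)
open import Data.Sum using (_⊎_; inj₁; inj₂; [_,_]′)
open import Data.Empty using (⊥; ⊥-elim)
open import Function using (_∘_; id)
open import Function.Definitions using (Injective; Surjective)
open import Relation.Binary.PropositionalEquality
open import Relation.Nullary using (¬_; Dec; yes; no; contradiction; ¬?)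
open import Relation.Nullary.Decidable using (map′; _×-dec_; decidable-stable)
open import Relation.Unary using (Decidable)
open import Algebra.Bundles using (AbelianGroup)

m<n+n⇒⌊m/2⌋<n : ∀ {m n} → m < n + n → ⌊ m /2⌋ < n
m<n+n⇒⌊m/2⌋<n {zero}        {suc n} _ = s≤s z≤n
m<n+n⇒⌊m/2⌋<n {suc zero}    {suc n} _ = s≤s z≤n
m<n+n⇒⌊m/2⌋<n {suc (suc m)} {suc n} (s≤s lt) =
  s≤s (m<n+n⇒⌊m/2⌋<n (≤-pred (subst (suc (suc m) ≤_) (+-suc n n) lt)))

n<2^[k+1]⇒⌊log₂n⌋≤k : ∀ {n} k → n < 2 ^ (k + 1) → ⌊log₂ n ⌋ ≤ k
n<2^[k+1]⇒⌊log₂n⌋≤k {zero}     zero _ = z≤n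
n<2^[k+1]⇒⌊log₂n⌋≤k {suc zero} zero _ = z≤n
n<2^[k+1]⇒⌊log₂n⌋≤k {suc (suc n)} zero (s≤s (s≤s ()))
n<2^[k+1]⇒⌊log₂n⌋≤k {n} (suc k) lt = ≤-trans (m≤n+m∸n ⌊log₂ n ⌋ 1) (s≤s (begin
  ⌊log₂ n ⌋ ∸ 1    ≡⟨ sym (⌊log₂⌊n/2⌋⌋≡⌊log₂n⌋∸1 n) ⟩
  ⌊log₂ ⌊ n /2⌋ ⌋  ≤⟨ n<2^[k+1]⇒⌊log₂n⌋≤k k (m<n+n⇒⌊m/2⌋<n n<2^[k+1]+2^[k+1]) ⟩
  k                ∎))
  where
  open ≤-Reasoning
  n<2^[k+1]+2^[k+1] : n < 2 ^ (k + 1) + 2 ^ (k + 1)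
  n<2^[k+1]+2^[k+1] = subst (n <_) (cong (2 ^ (k + 1) +_) (+-identityʳ _)) lt

2^k≤n⇒k≤⌊log₂n⌋ : ∀ {n} k → 2 ^ k ≤ n → k ≤ ⌊log₂ n ⌋
2^k≤n⇒k≤⌊log₂n⌋ k le = subst (_≤ _) (⌊log₂[2^n]⌋≡n k) (⌊log₂⌋-mono-≤ le)

⌊log₂⌋-unique : ∀ {n} k → 2 ^ k ≤ n → n < 2 ^ (k + 1) → ⌊log₂ n ⌋ ≡ k
⌊log₂⌋-unique k lo hi = ≤-antisym (n<2^[k+1]⇒⌊log₂n⌋≤k k hi) (2^k≤n⇒k≤⌊log₂n⌋ k lo)

n<2^[⌊log₂n⌋+1] : ∀ n → n < 2 ^ (⌊log₂ n ⌋ + 1)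
n<2^[⌊log₂n⌋+1] n with 2 ^ (⌊log₂ n ⌋ + 1) ≤? n
... | yes le = contradiction (2^k≤n⇒k≤⌊log₂n⌋ _ le) (m+1+n≰m ⌊log₂ n ⌋)
... | no  nle = ≰⇒> nle

2^⌊log₂n⌋≤n : ∀ n .{{_ : NonZero n}} → 2 ^ ⌊log₂ n ⌋ ≤ n
2^⌊log₂n⌋≤n n with ⌊log₂ n ⌋ in eq
... | zero  = >-nonZero⁻¹ n
... | suc k with 2 ^ suc k ≤? n
...   | yes le  = le
...   | no  nle = contradiction (subst (_≤ k) eq (n<2^[k+1]⇒⌊log₂n⌋≤k k n<2^[k+1])) (n≮n k)
  where n<2^[k+1] : n < 2 ^ (k + 1)
        n<2^[k+1] = subst (λ e → n < 2 ^ e) (+-comm 1 k) (≰⇒> nle)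

2^[⌊log₂m⌋+⌊log₂n⌋]≤m*n : ∀ m n .{{_ : NonZero m}} .{{_ : NonZero n}} →
                          2 ^ (⌊log₂ m ⌋ + ⌊log₂ n ⌋) ≤ m * n
2^[⌊log₂m⌋+⌊log₂n⌋]≤m*n m n = subst (_≤ m * n) (sym (^-distribˡ-+-* 2 ⌊log₂ m ⌋ ⌊log₂ n ⌋))
  (*-mono-≤ (2^⌊log₂n⌋≤n m) (2^⌊log₂n⌋≤n n))

fracLogSumLt1-2^ : ∀ m n → FracLogSumLt1 (2 ^ m) n
fracLogSumLt1-2^ m n = begin-strict
  2 ^ m * n                            <⟨ *-monoʳ-< (2 ^ m) {{m^n≢0 2 m}} (n<2^[⌊log₂n⌋+1] n) ⟩
  2 ^ m * 2 ^ (⌊log₂ n ⌋ + 1)          ≡⟨ sym (^-distribˡ-+-* 2 m (⌊log₂ n ⌋ + 1)) ⟩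
  2 ^ (m + (⌊log₂ n ⌋ + 1))            ≡⟨ cong (2 ^_) (sym (+-assoc m ⌊log₂ n ⌋ 1)) ⟩
  2 ^ (m + ⌊log₂ n ⌋ + 1)              ≡⟨ cong (λ k → 2 ^ (k + ⌊log₂ n ⌋ + 1)) (sym (⌊log₂[2^n]⌋≡n m)) ⟩
  2 ^ (⌊log₂ 2 ^ m ⌋ + ⌊log₂ n ⌋ + 1)  ∎
  where open ≤-Reasoning

crossing : ∀ {p} {P : ℕ → Set p} → Decidable P → ¬ P 0 → ∀ n → P n → ∃ λ t → ¬ P t × P (suc t)
crossing P? ¬P₀ zero    P₀ = contradiction P₀ ¬P₀
crossing P? ¬P₀ (suc n) Pₙ₊₁ with P? n
... | yes Pₙ = crossing P? ¬P₀ n Pₙ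
... | no ¬Pₙ = n , ¬Pₙ , Pₙ₊₁

funToFin-cong : ∀ {m n} {f g : Fin m → Fin n} → f ≗ g → funToFin f ≡ funToFin g
funToFin-cong {zero}  f≗g = refl
funToFin-cong {suc m} f≗g = cong₂ combine (f≗g zero) (funToFin-cong (f≗g ∘ suc))

finToFun-distinct : ∀ {m n} {i j : Fin (m ^ n)} → i ≢ j → ∃ λ t → finToFun i t ≢ finToFun j t
finToFun-distinct {m} {n} {i} {j} i≢j = ¬∀⟶∃¬ n _ (λ t → finToFun i t ≟ finToFun j t) λ i≗j →
  i≢j (trans (sym (funToFin-finToFin {n} {m} i)) (trans (funToFin-cong i≗j) (funToFin-finToFin {n} {m} j)))

_≟absent : (s : Sign) → Dec (s ≡ absent)
absent ≟absent = yes refl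
plus   ≟absent = no λ ()
minus  ≟absent = no λ ()

support? : ∀ {k} (a : Fin k → Sign) → (∃ λ i → a i ≢ absent) ⊎ (∀ i → a i ≡ absent)
support? a with any? (λ i → ¬? (a i ≟absent))
... | yes nonAbsent = inj₁ nonAbsent
... | no  ¬nonAbsent = inj₂ λ i → decidable-stable (a i ≟absent) (λ aᵢ≢absent → ¬nonAbsent (i , aᵢ≢absent))

support-↑ʳ : ∀ {k l} (a : Fin (k + l) → Sign) → (∀ j → a (j ↑ˡ l) ≡ absent) →
  (∃ λ i → a i ≢ absent) → ∃ λ j → a (k ↑ʳ j) ≢ absent
support-↑ʳ {k} a leftAbsent (i , aᵢ≢absent) with splitAt k i in eq
... | inj₁ j = contradiction (trans (cong a (sym (splitAt⁻¹-↑ˡ eq))) (leftAbsent j)) aᵢ≢absent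
... | inj₂ j = j , λ aⱼ≡absent → aᵢ≢absent (trans (cong a (sym (splitAt⁻¹-↑ʳ eq))) aⱼ≡absent)

isDpm-intro : ∀ {G n} → PMGood G (n + 1) → ¬ PMGood G n → IsDpm G (n + 1)
isDpm-intro {G} {n} good ¬good = m≤n+m 1 n , good , minimal
  where
  minimal : ∀ m → 1 ≤ m → PMGood G m → n + 1 ≤ m
  minimal m _ goodₘ with m ≤? n
  ... | yes m≤n = contradiction (λ k n≤k → goodₘ k (≤-trans m≤n n≤k)) ¬good
  ... | no  m≰n = subst (_≤ m) (+-comm 1 n) (≰⇒> m≰n)

isDpm⇒¬PMGood : ∀ {G n} → IsDpm G (n + 1) → ¬ PMGood G n
isDpm⇒¬PMGood {n = zero} _ good with good 0 z≤n (λ ())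
... | _ , (() , _) , _
isDpm⇒¬PMGood {n = suc n} (_ , _ , minimal) good = m+1+n≰m (suc n) (minimal (suc n) (s≤s z≤n) good)

module FinAbGroupProperties (G : FinAbGroup) where

  abelianGroup : AbelianGroup 0ℓ 0ℓ
  abelianGroup = record
    { Carrier = Carrier G ; _≈_ = _≡_ ; _∙_ = FinAbGroup._∙_ G ; ε = FinAbGroup.ε G
    ; _⁻¹ = FinAbGroup._⁻¹ G ; isAbelianGroup = isAbelianGroup G }

  open AbelianGroup abelianGroup public
    using (_∙_; ε; _⁻¹; assoc; comm; identityˡ; identityʳ; inverseˡ; inverseʳ;
           monoid; commutativeSemigroup; commutativeMonoid)
  open import Algebra.Properties.AbelianGroup abelianGroup public
  open import Algebra.Properties.CommutativeSemigroup commutativeSemigroup public using (interchange)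
  open import Algebra.Properties.CommutativeMonoid.Sum commutativeMonoid public
    using (sum; sum-cong-≗; ∑-distrib-+; sum-permute; sum-replicate; sum-replicate-zero)
  open import Algebra.Properties.Monoid.Mult monoid public
    using (×-homo-1; ×-homo-+) renaming (_×_ to _×ᵍ_)

  gsum≡sum : ∀ k (x : Fin k → Carrier G) → gsum G k x ≡ sum x
  gsum≡sum zero    x = refl
  gsum≡sum (suc k) x = cong (x zero ∙_) (gsum≡sum k (x ∘ suc))

  sum-↑ : ∀ k {l} (x : Fin (k + l) → Carrier G) → sum x ≡ sum (x ∘ (_↑ˡ l)) ∙ sum (x ∘ (k ↑ʳ_))
  sum-↑ zero    x = sym (identityˡ _)
  sum-↑ (suc k) x = trans (cong (x zero ∙_) (sum-↑ k (x ∘ suc))) (sym (assoc _ _ _))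

  sum-⁻¹ : ∀ {k} (x : Fin k → Carrier G) → sum (λ i → x i ⁻¹) ≡ sum x ⁻¹
  sum-⁻¹ {zero}  x = sym ε⁻¹≈ε
  sum-⁻¹ {suc k} x = trans (cong (x zero ⁻¹ ∙_) (sum-⁻¹ (x ∘ suc))) (⁻¹-∙-comm _ _)

  signedSum : ∀ {k} → (Fin k → Sign) → (Fin k → Carrier G) → Carrier G
  signedSum a x = sum (λ i → signed G (a i) (x i))

  signedSum-++ : ∀ {k l} (a : Fin (k + l) → Sign) (x : Fin k → Carrier G) (y : Fin l → Carrier G) →
    signedSum a (x ++ y) ≡ signedSum (a ∘ (_↑ˡ l)) x ∙ signedSum (a ∘ (k ↑ʳ_)) y
  signedSum-++ {k} {l} a x y = trans (sum-↑ k _) (cong₂ _∙_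
    (sum-cong-≗ λ i → cong (signed G (a (i ↑ˡ l))) (lookup-++ˡ x y i))
    (sum-cong-≗ λ j → cong (signed G (a (k ↑ʳ j))) (lookup-++ʳ x y j)))

  signed-ε : ∀ s → signed G s ε ≡ ε
  signed-ε absent = refl
  signed-ε plus   = refl
  signed-ε minus  = ε⁻¹≈ε

  signedSum-ε : ∀ {k} (a : Fin k → Sign) → signedSum a (λ _ → ε) ≡ ε
  signedSum-ε {k} a = trans (sum-cong-≗ (λ i → signed-ε (a i))) (sum-replicate-zero k)

  signedSum-absent : ∀ {k} {a : Fin k → Sign} (x : Fin k → Carrier G) →
                     (∀ i → a i ≡ absent) → signedSum a x ≡ ε
  signedSum-absent {k} x allAbsent =
    trans (sum-cong-≗ (λ i → cong (λ s → signed G s (x i)) (allAbsent i))) (sum-replicate-zero k)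

  -- A subset of Fin k is an indicator function Fin k → Fin 2, so that finToFun enumerates
  -- all of them as Fin (2 ^ k).
  select : Fin 2 → Carrier G → Carrier G
  select 0F x = ε
  select 1F x = x

  subsetSum : ∀ {k} → (Fin k → Carrier G) → (Fin k → Fin 2) → Carrier G
  subsetSum x A = sum (λ i → select (A i) (x i))

  subsetSum-cong : ∀ {k} (x : Fin k → Carrier G) {A B} → A ≗ B → subsetSum x A ≡ subsetSum x B
  subsetSum-cong x A≗B = sum-cong-≗ (λ i → cong (λ b → select b (x i)) (A≗B i))

  Collision : ∀ {k} → (Fin k → Carrier G) → Set
  Collision {k} x = ∃₂ λ (A B : Fin k → Fin 2) → (∃ λ i → A i ≢ B i) × subsetSum x A ≡ subsetSum x B

  weight : Fin 2 → Fin 2 → Sign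
  weight 1F 0F = plus
  weight 0F 1F = minus
  weight _  _  = absent

  weight-≢ : ∀ {a b} → a ≢ b → weight a b ≢ absent
  weight-≢ {0F} {0F} a≢b = contradiction refl a≢b
  weight-≢ {0F} {1F} _ ()
  weight-≢ {1F} {0F} _ ()
  weight-≢ {1F} {1F} a≢b = contradiction refl a≢b

  signed-weight : ∀ a b x → signed G (weight a b) x ≡ select a x ∙ select b x ⁻¹
  signed-weight 0F 0F x = sym (x≈y⇒x∙y⁻¹≈ε refl)
  signed-weight 0F 1F x = sym (identityˡ (x ⁻¹))
  signed-weight 1F 0F x = sym (trans (cong (x ∙_) ε⁻¹≈ε) (identityʳ x))
  signed-weight 1F 1F x = sym (inverseʳ x)

  positive negative : Sign → Fin 2
  positive plus  = 1F
  positive _     = 0F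
  negative minus = 1F
  negative _     = 0F

  weight-parts : ∀ s → weight (positive s) (negative s) ≡ s
  weight-parts absent = refl
  weight-parts plus   = refl
  weight-parts minus  = refl

  parts-≢ : ∀ {s} → s ≢ absent → positive s ≢ negative s
  parts-≢ {absent} s≢absent = contradiction refl s≢absent
  parts-≢ {plus}   _ ()
  parts-≢ {minus}  _ ()

  weightedSum : ∀ {k} (x : Fin k → Carrier G) (A B : Fin k → Fin 2) →
    signedSum (λ i → weight (A i) (B i)) x ≡ subsetSum x A ∙ subsetSum x B ⁻¹
  weightedSum x A B = begin
    signedSum (λ i → weight (A i) (B i)) x
      ≡⟨ sum-cong-≗ (λ i → signed-weight (A i) (B i) (x i)) ⟩
    sum (λ i → select (A i) (x i) ∙ select (B i) (x i) ⁻¹)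
      ≡⟨ ∑-distrib-+ (λ i → select (A i) (x i)) (λ i → select (B i) (x i) ⁻¹) ⟩
    subsetSum x A ∙ sum (λ i → select (B i) (x i) ⁻¹)
      ≡⟨ cong (subsetSum x A ∙_) (sum-⁻¹ (λ i → select (B i) (x i))) ⟩
    subsetSum x A ∙ subsetSum x B ⁻¹ ∎
    where open ≡-Reasoning

  collision⇒hasPMZeroSum : ∀ {k} {x : Fin k → Carrier G} → Collision x → HasPMZeroSum G k x
  collision⇒hasPMZeroSum {k} {x} (A , B , (i , Aᵢ≢Bᵢ) , eq) =
    (λ j → weight (A j) (B j)) , (i , weight-≢ Aᵢ≢Bᵢ) ,
    trans (gsum≡sum k _) (trans (weightedSum x A B) (x≈y⇒x∙y⁻¹≈ε eq))

  hasPMZeroSum⇒collision : ∀ {k} {x : Fin k → Carrier G} → HasPMZeroSum G k x → Collision x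
  hasPMZeroSum⇒collision {k} {x} (a , (i , aᵢ≢absent) , zeroSum) =
    positive ∘ a , negative ∘ a , (i , parts-≢ aᵢ≢absent) ,
    x∙y⁻¹≈ε⇒x≈y _ _ (begin
      subsetSum x (positive ∘ a) ∙ subsetSum x (negative ∘ a) ⁻¹
        ≡⟨ weightedSum x (positive ∘ a) (negative ∘ a) ⟨
      signedSum (λ i → weight (positive (a i)) (negative (a i))) x
        ≡⟨ sum-cong-≗ (λ i → cong (λ s → signed G s (x i)) (weight-parts (a i))) ⟩
      signedSum a x
        ≡⟨ gsum≡sum k _ ⟨
      gsum G k (λ i → signed G (a i) (x i))
        ≡⟨ zeroSum ⟩
      ε ∎)
    where open ≡-Reasoning

  collision? : ∀ {k} (x : Fin k → Carrier G) → Dec (Collision x)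
  collision? {k} x = map′ decode encode (any? λ i → any? λ j →
      any? (λ t → ¬? (finToFun i t ≟ finToFun j t)) ×-dec
      (subsetSum x (finToFun i) ≟ subsetSum x (finToFun j)))
    where
    Coded : Set
    Coded = ∃₂ λ (i j : Fin (2 ^ k)) → (∃ λ t → finToFun i t ≢ finToFun j t) ×
              subsetSum x (finToFun i) ≡ subsetSum x (finToFun j)

    decode : Coded → Collision x
    decode (i , j , distinct , eq) = finToFun i , finToFun j , distinct , eq

    encode : Collision x → Coded
    encode (A , B , (t , Aₜ≢Bₜ) , eq) = funToFin A , funToFin B ,
      (t , λ eqₜ → Aₜ≢Bₜ (trans (sym (finToFun-funToFin A t)) (trans eqₜ (finToFun-funToFin B t)))) ,
      trans (subsetSum-cong x (finToFun-funToFin A)) (trans eq (sym (subsetSum-cong x (finToFun-funToFin B))))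

  hasPMZeroSum? : ∀ k (x : Fin k → Carrier G) → Dec (HasPMZeroSum G k x)
  hasPMZeroSum? k x = map′ collision⇒hasPMZeroSum hasPMZeroSum⇒collision (collision? x)

  card<2^n⇒PMGood : ∀ n → card G < 2 ^ n → PMGood G n
  card<2^n⇒PMGood n |G|<2ⁿ k n≤k x
    with pigeonhole (<-≤-trans |G|<2ⁿ (^-monoʳ-≤ 2 n≤k)) (subsetSum x ∘ finToFun)
  ... | i , j , i<j , eq = collision⇒hasPMZeroSum (finToFun i , finToFun j , finToFun-distinct (<⇒≢ i<j) , eq)

  card×ᵍ≡ε : ∀ q → card G ×ᵍ q ≡ ε
  card×ᵍ≡ε q = ∙-cancelˡ total _ _ (begin
    total ∙ card G ×ᵍ q            ≡⟨ cong (total ∙_) (sym (sum-replicate (card G))) ⟩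
    total ∙ sum {card G} (λ _ → q) ≡⟨ sym (∑-distrib-+ {card G} id (λ _ → q)) ⟩
    sum (λ x → x ∙ q)             ≡⟨ sym (sum-permute id translation) ⟩
    total                         ≡⟨ sym (identityʳ total) ⟩
    total ∙ ε                     ∎)
    where
    open ≡-Reasoning
    total : Carrier G
    total = sum id
    translation : Permutation′ (card G)
    translation = permutation (_∙ q) (_∙ q ⁻¹)
      (λ x → trans (assoc x (q ⁻¹) q) (trans (cong (x ∙_) (inverseˡ q)) (identityʳ x)))
      (λ x → trans (assoc x q (q ⁻¹)) (trans (cong (x ∙_) (inverseʳ q)) (identityʳ x)))

module HomProperties {G H : FinAbGroup} (φ : Hom G H) where
  private
    module G = FinAbGroupProperties G
    module H = FinAbGroupProperties H

  hom-ε : fun φ G.ε ≡ H.ε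
  hom-ε = H.∙-cancelˡ (fun φ G.ε) _ _
    (trans (sym (homo φ G.ε G.ε)) (trans (cong (fun φ) (G.identityˡ G.ε)) (sym (H.identityʳ _))))

  hom-⁻¹ : ∀ x → fun φ (x G.⁻¹) ≡ fun φ x H.⁻¹
  hom-⁻¹ x = H.inverseʳ-unique (fun φ x) (fun φ (x G.⁻¹))
    (trans (sym (homo φ x (x G.⁻¹))) (trans (cong (fun φ) (G.inverseʳ x)) hom-ε))

  hom-signed : ∀ s x → fun φ (signed G s x) ≡ signed H s (fun φ x)
  hom-signed absent x = hom-ε
  hom-signed plus   x = refl
  hom-signed minus  x = hom-⁻¹ x

  hom-sum : ∀ {k} (x : Fin k → Carrier G) → fun φ (G.sum x) ≡ H.sum (fun φ ∘ x)
  hom-sum {zero}  x = hom-ε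
  hom-sum {suc k} x = trans (homo φ _ _) (cong (fun φ (x zero) H.∙_) (hom-sum (x ∘ suc)))

  hom-signedSum : ∀ {k} (a : Fin k → Sign) (x : Fin k → Carrier G) →
    fun φ (G.signedSum a x) ≡ H.signedSum a (fun φ ∘ x)
  hom-signedSum a x = trans (hom-sum (λ i → signed G (a i) (x i))) (H.sum-cong-≗ λ i → hom-signed (a i) (x i))

module ExtensionProperties
  {G H₁ H₂ : FinAbGroup} (ι : Hom H₂ G) (π : Hom G H₁)
  (ι-injective : Injective _≡_ _≡_ (fun ι)) (π-surjective : Surjective _≡_ _≡_ (fun π))
  (ker-π⊆im-ι : ∀ g → fun π g ≡ FinAbGroup.ε H₁ → ∃ λ h → fun ι h ≡ g)
  (π∘ι≡ε : ∀ h → fun π (fun ι h) ≡ FinAbGroup.ε H₁)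
  where

  private
    module G = FinAbGroupProperties G
    module H₁ = FinAbGroupProperties H₁
    module H₂ = FinAbGroupProperties H₂
    module ι = HomProperties ι
    module π = HomProperties π

  section : Carrier H₁ → Carrier G
  section a = proj₁ (π-surjective a)

  π∘section : ∀ a → fun π (section a) ≡ a
  π∘section a = proj₂ (π-surjective a) refl

  pair : Carrier H₁ → Carrier H₂ → Carrier G
  pair a h = section a G.∙ fun ι h

  π∘pair : ∀ a h → fun π (pair a h) ≡ a
  π∘pair a h = trans (homo π _ _) (trans (cong₂ H₁._∙_ (π∘section a) (π∘ι≡ε h)) (H₁.identityʳ a))

  pair-injective : ∀ {a h b k} → pair a h ≡ pair b k → a ≡ b × h ≡ k
  pair-injective {a} {h} {b} {k} eq =
    a≡b , ι-injective (G.∙-cancelˡ _ _ _ (trans eq (cong (λ c → pair c k) (sym a≡b))))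
    where
    a≡b : a ≡ b
    a≡b = trans (sym (π∘pair a h)) (trans (cong (fun π) eq) (π∘pair b k))

  kernelPart : Carrier G → Carrier H₂
  kernelPart g = proj₁ (ker-π⊆im-ι (g G.∙ section (fun π g) G.⁻¹) (begin
    fun π (g G.∙ section (fun π g) G.⁻¹)        ≡⟨ homo π _ _ ⟩
    fun π g H₁.∙ fun π (section (fun π g) G.⁻¹) ≡⟨ cong (fun π g H₁.∙_) (π.hom-⁻¹ _) ⟩
    fun π g H₁.∙ fun π (section (fun π g)) H₁.⁻¹ ≡⟨ cong (λ a → fun π g H₁.∙ a H₁.⁻¹) (π∘section _) ⟩
    fun π g H₁.∙ fun π g H₁.⁻¹                   ≡⟨ H₁.inverseʳ _ ⟩
    H₁.ε                                          ∎))
    where open ≡-Reasoning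

  pair-kernelPart : ∀ g → pair (fun π g) (kernelPart g) ≡ g
  pair-kernelPart g = trans (cong (section (fun π g) G.∙_) (proj₂ (ker-π⊆im-ι _ _)))
    (trans (sym (G.assoc _ _ _)) (G.xyx⁻¹≈y _ g))

  card-extension : card G ≡ card H₁ * card H₂
  card-extension = ≤-antisym (injective⇒≤ {f = encode} encode-injective) (injective⇒≤ {f = decode} decode-injective)
    where
    encode : Carrier G → Fin (card H₁ * card H₂)
    encode g = combine (fun π g) (kernelPart g)

    encode-injective : Injective _≡_ _≡_ encode
    encode-injective {g} {g′} eq with combine-injective _ _ _ _ eq
    ... | πg≡πg′ , kg≡kg′ =
      trans (sym (pair-kernelPart g)) (trans (cong₂ pair πg≡πg′ kg≡kg′) (pair-kernelPart g′))

    decode : Fin (card H₁ * card H₂) → Carrier G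
    decode i = uncurry pair (remQuot {card H₁} (card H₂) i)

    decode-injective : Injective _≡_ _≡_ decode
    decode-injective {i} {j} eq with pair-injective eq
    ... | a≡b , h≡k = trans (sym (combine-remQuot {card H₁} (card H₂) i))
      (trans (cong₂ combine a≡b h≡k) (combine-remQuot {card H₁} (card H₂) j))

  module _ {k l} (f : Fin k → Carrier H₁) (u : Fin l → Carrier H₂) (a : Fin (k + l) → Sign)
           (zeroSum : gsum G (k + l) (λ i → signed G (a i) (((section ∘ f) ++ (fun ι ∘ u)) i)) ≡ G.ε) where

    private
      a₁ : Fin k → Sign
      a₁ = a ∘ (_↑ˡ l)
      a₂ : Fin l → Sign
      a₂ = a ∘ (k ↑ʳ_)

      X Y : Carrier G
      X = G.signedSum a₁ (section ∘ f)
      Y = G.signedSum a₂ (fun ι ∘ u)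

      X∙Y≡ε : X G.∙ Y ≡ G.ε
      X∙Y≡ε = trans (sym (G.signedSum-++ a (section ∘ f) (fun ι ∘ u))) (trans (sym (G.gsum≡sum (k + l) _)) zeroSum)

      πY≡ε : fun π Y ≡ H₁.ε
      πY≡ε = trans (π.hom-signedSum a₂ (fun ι ∘ u))
        (trans (H₁.sum-cong-≗ λ j → cong (signed H₁ (a₂ j)) (π∘ι≡ε (u j))) (H₁.signedSum-ε a₂))

    projected-zeroSum : gsum H₁ k (λ i → signed H₁ (a₁ i) (f i)) ≡ H₁.ε
    projected-zeroSum = begin
      gsum H₁ k (λ i → signed H₁ (a₁ i) (f i)) ≡⟨ H₁.gsum≡sum k _ ⟩
      H₁.signedSum a₁ f
        ≡⟨ H₁.sum-cong-≗ (λ i → cong (signed H₁ (a₁ i)) (sym (π∘section (f i)))) ⟩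
      H₁.signedSum a₁ (fun π ∘ section ∘ f) ≡⟨ sym (π.hom-signedSum a₁ (section ∘ f)) ⟩
      fun π X                               ≡⟨ sym (H₁.identityʳ _) ⟩
      fun π X H₁.∙ H₁.ε                     ≡⟨ cong (fun π X H₁.∙_) (sym πY≡ε) ⟩
      fun π X H₁.∙ fun π Y                  ≡⟨ sym (homo π X Y) ⟩
      fun π (X G.∙ Y)                       ≡⟨ cong (fun π) X∙Y≡ε ⟩
      fun π G.ε                             ≡⟨ π.hom-ε ⟩
      H₁.ε                                  ∎
      where open ≡-Reasoning

    kernel-zeroSum : (∀ i → a₁ i ≡ absent) → gsum H₂ l (λ j → signed H₂ (a₂ j) (u j)) ≡ H₂.ε
    kernel-zeroSum a₁-absent = trans (H₂.gsum≡sum l _) (ι-injective (begin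
      fun ι (H₂.signedSum a₂ u) ≡⟨ ι.hom-signedSum a₂ u ⟩
      Y                         ≡⟨ sym (G.identityˡ Y) ⟩
      G.ε G.∙ Y                 ≡⟨ cong (G._∙ Y) (sym (G.signedSum-absent (section ∘ f) a₁-absent)) ⟩
      X G.∙ Y                   ≡⟨ X∙Y≡ε ⟩
      G.ε                       ≡⟨ sym ι.hom-ε ⟩
      fun ι H₂.ε                ∎))
      where open ≡-Reasoning

  hasPMZeroSum-lift : ∀ {k l} (f : Fin k → Carrier H₁) (u : Fin l → Carrier H₂) →
    HasPMZeroSum G (k + l) ((section ∘ f) ++ (fun ι ∘ u)) → HasPMZeroSum H₁ k f ⊎ HasPMZeroSum H₂ l u
  hasPMZeroSum-lift {k} {l} f u (a , support , zeroSum) with support? (a ∘ (_↑ˡ l))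
  ... | inj₁ leftSupport = inj₁ (a ∘ (_↑ˡ l) , leftSupport , projected-zeroSum f u a zeroSum)
  ... | inj₂ leftAbsent  =
    inj₂ (a ∘ (k ↑ʳ_) , support-↑ʳ a leftAbsent support , kernel-zeroSum f u a zeroSum leftAbsent)

  -- ¬ PMGood H₁ n₁ provides no zero-sum free sequence of H₁ to lift, so it is refuted by
  -- proving PMGood H₁ n₁ one sequence at a time, using that zero sums are decidable.
  PMGood-extension : ∀ {n₁ n₂} → PMGood G (n₁ + n₂) → ¬ PMGood H₁ n₁ → PMGood H₂ n₂
  PMGood-extension {n₁} good ¬good₁ l n₂≤l u with H₂.hasPMZeroSum? l u
  ... | yes has₂ = has₂
  ... | no ¬has₂ = contradiction good₁ ¬good₁
    where
    good₁ : PMGood H₁ n₁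
    good₁ k n₁≤k f with H₁.hasPMZeroSum? k f
    ... | yes has₁ = has₁
    ... | no ¬has₁ =
      ⊥-elim ([ ¬has₁ , ¬has₂ ]′ (hasPMZeroSum-lift f u (good (k + l) (+-mono-≤ n₁≤k n₂≤l) _)))

module BinaryBases (G : FinAbGroup) where
  open FinAbGroupProperties G

  IsSubsetSum : ∀ {k} → (Fin k → Carrier G) → Carrier G → Set
  IsSubsetSum x y = ∃ λ A → subsetSum x A ≡ y

  isSubsetSum? : ∀ {k} (x : Fin k → Carrier G) y → Dec (IsSubsetSum x y)
  isSubsetSum? x y = map′ decode encode (any? λ i → subsetSum x (finToFun i) ≟ y)
    where
    decode : (∃ λ i → subsetSum x (finToFun i) ≡ y) → IsSubsetSum x y
    decode (i , eq) = finToFun i , eq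
    encode : IsSubsetSum x y → ∃ λ i → subsetSum x (finToFun i) ≡ y
    encode (A , eq) = funToFin A , trans (subsetSum-cong x (finToFun-funToFin A)) eq

  ε-isSubsetSum : ∀ {k} (x : Fin k → Carrier G) → IsSubsetSum x ε
  ε-isSubsetSum {k} x = (λ _ → 0F) , sum-replicate-zero k

  record IsBinaryBasis {k} (x : Fin k → Carrier G) : Set where
    field
      ∙-closed            : ∀ {u v} → IsSubsetSum x u → IsSubsetSum x v → IsSubsetSum x (u ∙ v)
      ⁻¹-closed           : ∀ {u} → IsSubsetSum x u → IsSubsetSum x (u ⁻¹)
      subsetSum-injective : ∀ A B → subsetSum x A ≡ subsetSum x B → A ≗ B

  []-isBinaryBasis : IsBinaryBasis []
  []-isBinaryBasis = record
    { ∙-closed            = λ (_ , ε≡u) (_ , ε≡v) → (λ ()) , trans (sym (identityˡ ε)) (cong₂ _∙_ ε≡u ε≡v)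
    ; ⁻¹-closed           = λ (_ , ε≡u) → (λ ()) , trans (sym ε⁻¹≈ε) (cong _⁻¹ ε≡u)
    ; subsetSum-injective = λ _ _ _ ()
    }

  module _ {k} {x : Fin k → Carrier G} (basis : IsBinaryBasis x) {z : Carrier G}
           (z∉ : ¬ IsSubsetSum x z) (z∙z∈ : IsSubsetSum x (z ∙ z)) where
    open IsBinaryBasis basis

    private
      split : ∀ {u} → IsSubsetSum (z ∷ x) u → ∃₂ λ b s → IsSubsetSum x s × select b z ∙ s ≡ u
      split (A , eq) = A zero , _ , (A ∘ suc , refl) , eq

      join : ∀ b {s} → IsSubsetSum x s → IsSubsetSum (z ∷ x) (select b z ∙ s)
      join b (A , eq) = b ∷ A , cong (select b z ∙_) eq

      select-∙ : ∀ b c → ∃₂ λ d r → IsSubsetSum x r × select b z ∙ select c z ≡ select d z ∙ r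
      select-∙ 0F 0F = 0F , ε , ε-isSubsetSum x , refl
      select-∙ 0F 1F = 1F , ε , ε-isSubsetSum x , comm ε z
      select-∙ 1F 0F = 1F , ε , ε-isSubsetSum x , refl
      select-∙ 1F 1F = 0F , z ∙ z , z∙z∈ , sym (identityˡ _)

      select-⁻¹ : ∀ b → ∃ λ r → IsSubsetSum x r × select b z ⁻¹ ≡ select b z ∙ r
      select-⁻¹ 0F = ε , ε-isSubsetSum x , trans ε⁻¹≈ε (sym (identityˡ ε))
      select-⁻¹ 1F = (z ∙ z) ⁻¹ , ⁻¹-closed z∙z∈ , sym (begin
        z ∙ (z ∙ z) ⁻¹       ≡⟨ cong (z ∙_) (sym (⁻¹-∙-comm z z)) ⟩
        z ∙ (z ⁻¹ ∙ z ⁻¹)    ≡⟨ sym (assoc z (z ⁻¹) (z ⁻¹)) ⟩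
        (z ∙ z ⁻¹) ∙ z ⁻¹    ≡⟨ cong (_∙ z ⁻¹) (inverseʳ z) ⟩
        ε ∙ z ⁻¹             ≡⟨ identityˡ (z ⁻¹) ⟩
        z ⁻¹                 ∎)
        where open ≡-Reasoning

      ∙-closed∷ : ∀ {u v} → IsSubsetSum (z ∷ x) u → IsSubsetSum (z ∷ x) v → IsSubsetSum (z ∷ x) (u ∙ v)
      ∙-closed∷ u∈ v∈ with split u∈ | split v∈
      ... | b , s , s∈ , refl | c , t , t∈ , refl with select-∙ b c
      ...   | d , r , r∈ , bc≡dr = subst (IsSubsetSum (z ∷ x)) (begin
        select d z ∙ (r ∙ (s ∙ t))           ≡⟨ sym (assoc _ r (s ∙ t)) ⟩
        (select d z ∙ r) ∙ (s ∙ t)           ≡⟨ cong (_∙ (s ∙ t)) (sym bc≡dr) ⟩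
        (select b z ∙ select c z) ∙ (s ∙ t)  ≡⟨ interchange _ _ s t ⟩
        (select b z ∙ s) ∙ (select c z ∙ t)  ∎) (join d (∙-closed r∈ (∙-closed s∈ t∈)))
        where open ≡-Reasoning

      ⁻¹-closed∷ : ∀ {u} → IsSubsetSum (z ∷ x) u → IsSubsetSum (z ∷ x) (u ⁻¹)
      ⁻¹-closed∷ u∈ with split u∈
      ... | b , s , s∈ , refl with select-⁻¹ b
      ...   | r , r∈ , b⁻¹≡br = subst (IsSubsetSum (z ∷ x)) (begin
        select b z ∙ (r ∙ s ⁻¹)       ≡⟨ sym (assoc _ r (s ⁻¹)) ⟩
        (select b z ∙ r) ∙ s ⁻¹       ≡⟨ cong (_∙ s ⁻¹) (sym b⁻¹≡br) ⟩
        select b z ⁻¹ ∙ s ⁻¹          ≡⟨ ⁻¹-∙-comm _ s ⟩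
        (select b z ∙ s) ⁻¹           ∎) (join b (∙-closed r∈ (⁻¹-closed s∈)))
        where open ≡-Reasoning

      z-difference : ∀ {s t} → IsSubsetSum x s → IsSubsetSum x t → z ∙ s ≡ ε ∙ t → ⊥
      z-difference {s} {t} s∈ t∈ eq = z∉ (subst (IsSubsetSum x) (begin
        t ∙ s ⁻¹          ≡⟨ cong (_∙ s ⁻¹) (trans (sym (identityˡ t)) (sym eq)) ⟩
        (z ∙ s) ∙ s ⁻¹    ≡⟨ cong (_∙ s ⁻¹) (comm z s) ⟩
        (s ∙ z) ∙ s ⁻¹    ≡⟨ xyx⁻¹≈y s z ⟩
        z                 ∎) (∙-closed t∈ (⁻¹-closed s∈)))
        where open ≡-Reasoning

      select-cancel : ∀ b c {s t} → IsSubsetSum x s → IsSubsetSum x t →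
                      select b z ∙ s ≡ select c z ∙ t → b ≡ c × s ≡ t
      select-cancel 0F 0F _  _  eq = refl , ∙-cancelˡ ε _ _ eq
      select-cancel 1F 1F _  _  eq = refl , ∙-cancelˡ z _ _ eq
      select-cancel 1F 0F s∈ t∈ eq = ⊥-elim (z-difference s∈ t∈ eq)
      select-cancel 0F 1F s∈ t∈ eq = ⊥-elim (z-difference t∈ s∈ (sym eq))

      injective∷ : ∀ A B → subsetSum (z ∷ x) A ≡ subsetSum (z ∷ x) B → A ≗ B
      injective∷ A B eq zero    = proj₁ (select-cancel (A zero) (B zero) (A ∘ suc , refl) (B ∘ suc , refl) eq)
      injective∷ A B eq (suc i) = subsetSum-injective (A ∘ suc) (B ∘ suc)
        (proj₂ (select-cancel (A zero) (B zero) (A ∘ suc , refl) (B ∘ suc , refl) eq)) i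

    ∷-isBinaryBasis : IsBinaryBasis (z ∷ x)
    ∷-isBinaryBasis = record
      { ∙-closed = ∙-closed∷ ; ⁻¹-closed = ⁻¹-closed∷ ; subsetSum-injective = injective∷ }

  nonSubsetSum : ∀ {k} → 2 ^ k < card G → (x : Fin k → Carrier G) → ∃ λ y → ¬ IsSubsetSum x y
  nonSubsetSum {k} 2ᵏ<|G| x with any? (λ y → ¬? (isSubsetSum? x y))
  ... | yes found = found
  ... | no ¬found = contradiction (injective⇒≤ {f = code} code-injective) (<⇒≱ 2ᵏ<|G|)
    where
    witness : ∀ y → IsSubsetSum x y
    witness y = decidable-stable (isSubsetSum? x y) (λ y∉ → ¬found (y , y∉))

    code : Carrier G → Fin (2 ^ k)
    code y = funToFin (proj₁ (witness y))

    decode-code : ∀ y → subsetSum x (finToFun (code y)) ≡ y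
    decode-code y = trans (subsetSum-cong x (finToFun-funToFin _)) (proj₂ (witness y))

    code-injective : Injective _≡_ _≡_ code
    code-injective {y} {y′} eq =
      trans (sym (decode-code y)) (trans (cong (subsetSum x ∘ finToFun) eq) (decode-code y′))

  2^suc-×ᵍ : ∀ t y → (2 ^ suc t) ×ᵍ y ≡ ((2 ^ t) ×ᵍ y) ∙ ((2 ^ t) ×ᵍ y)
  2^suc-×ᵍ t y = trans (×-homo-+ y (2 ^ t) (2 ^ t + 0))
    (cong (λ n → ((2 ^ t) ×ᵍ y) ∙ (n ×ᵍ y)) (+-identityʳ (2 ^ t)))

  nonSubsetSum-with-square-inside : ∀ {m k} → card G ≡ 2 ^ m → (x : Fin k → Carrier G) →
    ∀ {y} → ¬ IsSubsetSum x y → ∃ λ z → ¬ IsSubsetSum x z × IsSubsetSum x (z ∙ z)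
  nonSubsetSum-with-square-inside {m} |G|≡2ᵐ x {y} y∉
    with crossing (λ t → isSubsetSum? x ((2 ^ t) ×ᵍ y)) 1×ᵍy∉ m 2ᵐ×ᵍy∈
    where
    1×ᵍy∉ : ¬ IsSubsetSum x (1 ×ᵍ y)
    1×ᵍy∉ = y∉ ∘ subst (IsSubsetSum x) (×-homo-1 y)
    2ᵐ×ᵍy∈ : IsSubsetSum x ((2 ^ m) ×ᵍ y)
    2ᵐ×ᵍy∈ = subst (IsSubsetSum x) (sym (trans (cong (_×ᵍ y) (sym |G|≡2ᵐ)) (card×ᵍ≡ε y))) (ε-isSubsetSum x)
  ... | t , z∉ , z²∈ = (2 ^ t) ×ᵍ y , z∉ , subst (IsSubsetSum x) (2^suc-×ᵍ t y) z²∈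

  binaryBasis : ∀ {m} → card G ≡ 2 ^ m → ∀ k → k ≤ m → Σ (Fin k → Carrier G) IsBinaryBasis
  binaryBasis |G|≡2ᵐ zero    _   = [] , []-isBinaryBasis
  binaryBasis {m} |G|≡2ᵐ (suc k) k<m with binaryBasis |G|≡2ᵐ k (<⇒≤ k<m)
  ... | x , basis with nonSubsetSum (subst (2 ^ k <_) (sym |G|≡2ᵐ) (^-monoʳ-< 2 (s≤s (s≤s z≤n)) k<m)) x
  ...   | y , y∉ with nonSubsetSum-with-square-inside {m} |G|≡2ᵐ x y∉
  ...     | z , z∉ , z²∈ = z ∷ x , ∷-isBinaryBasis basis z∉ z²∈

  isBinaryBasis⇒¬HasPMZeroSum : ∀ {k} {x : Fin k → Carrier G} → IsBinaryBasis x → ¬ HasPMZeroSum G k x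
  isBinaryBasis⇒¬HasPMZeroSum basis has with hasPMZeroSum⇒collision has
  ... | A , B , (i , Aᵢ≢Bᵢ) , eq = Aᵢ≢Bᵢ (IsBinaryBasis.subsetSum-injective basis A B eq i)

open FinAbGroupProperties using (card<2^n⇒PMGood)

isDpm-extension : (H₁ H₂ : FinAbGroup) →
  IsDpm H₁ (⌊log₂ card H₁ ⌋ + 1) → IsDpm H₂ (⌊log₂ card H₂ ⌋ + 1) → FracLogSumLt1 (card H₁) (card H₂) →
  (G : FinAbGroup) → Extension G H₁ H₂ → IsDpm G (⌊log₂ card G ⌋ + 1)
isDpm-extension H₁ H₂ dpm₁ dpm₂ frac G (ι , π , ι-injective , π-surjective , ker-π⊆im-ι , π∘ι≡ε) =
  isDpm-intro (card<2^n⇒PMGood G _ (n<2^[⌊log₂n⌋+1] (card G))) λ good →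
    isDpm⇒¬PMGood dpm₂ (PMGood-extension (subst (PMGood G) log-card good) (isDpm⇒¬PMGood dpm₁))
  where
  open ExtensionProperties ι π ι-injective π-surjective ker-π⊆im-ι π∘ι≡ε

  log-card : ⌊log₂ card G ⌋ ≡ ⌊log₂ card H₁ ⌋ + ⌊log₂ card H₂ ⌋
  log-card = trans (cong ⌊log₂_⌋ card-extension) (⌊log₂⌋-unique _
    (2^[⌊log₂m⌋+⌊log₂n⌋]≤m*n (card H₁) (card H₂)
      {{nonZeroIndex (FinAbGroup.ε H₁)}} {{nonZeroIndex (FinAbGroup.ε H₂)}})
    frac)

isDpm-2-group : (Q : FinAbGroup) → Is2Group Q → IsDpm Q (⌊log₂ card Q ⌋ + 1)
isDpm-2-group Q (m , |Q|≡2ᵐ) = subst (λ n → IsDpm Q (n + 1)) (sym log-card) (isDpm-intro upper lower)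
  where
  open BinaryBases Q

  log-card : ⌊log₂ card Q ⌋ ≡ m
  log-card = trans (cong ⌊log₂_⌋ |Q|≡2ᵐ) (⌊log₂[2^n]⌋≡n m)

  upper : PMGood Q (m + 1)
  upper = card<2^n⇒PMGood Q (m + 1)
    (subst (_< 2 ^ (m + 1)) (sym |Q|≡2ᵐ) (^-monoʳ-< 2 (s≤s (s≤s z≤n)) (m<m+n m (s≤s z≤n))))

  lower : ¬ PMGood Q m
  lower good with binaryBasis |Q|≡2ᵐ m ≤-refl
  ... | x , basis = isBinaryBasis⇒¬HasPMZeroSum basis (good m ≤-refl x)

isDpm-extension-by-2-group : (G H Q : FinAbGroup) → Extension G Q H → IsDpm H (⌊log₂ card H ⌋ + 1) →
  Is2Group Q → IsDpm G (⌊log₂ card G ⌋ + 1)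
isDpm-extension-by-2-group G H Q ext dpm-H (m , |Q|≡2ᵐ) =
  isDpm-extension Q H (isDpm-2-group Q (m , |Q|≡2ᵐ)) dpm-H
    (subst (λ q → FracLogSumLt1 q (card H)) (sym |Q|≡2ᵐ) (fracLogSumLt1-2^ m (card H))) G ext

lemma2p5 :
    ((H₁ H₂ : FinAbGroup) →
      IsDpm H₁ (⌊log₂ card H₁ ⌋ + 1) →
      IsDpm H₂ (⌊log₂ card H₂ ⌋ + 1) →
      FracLogSumLt1 (card H₁) (card H₂) →
      (G : FinAbGroup) → Extension G H₁ H₂ →
      IsDpm G (⌊log₂ card G ⌋ + 1))
    ×
    ((G H Q : FinAbGroup) →
      Extension G Q H →
      IsDpm H (⌊log₂ card H ⌋ + 1) →
      Is2Group Q →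
      IsDpm G (⌊log₂ card G ⌋ + 1))
lemma2p5 = isDpm-extension , isDpm-extension-by-2-group
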